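{- Let $(L,\leq)$ be a finite lattice. Then a weak factorization system $(\mathcal{L},\mathcal{R})$ is on the spine of the lattice $\operatorname{Wfs}(L)$ if and only if $\mathcal{L}\cup\mathcal{R}=\operatorname{Rel}(L)$.
   Context: $\operatorname{Rel}(L)$ is the set of pairs $(a,b)$ with $a\leq b$. A relation $(a,b)$ lifts on the left $(c,d)$ if whenever $a\leq c$ and $b\leq d$ we have $b\leq c$. A weak factorization system on $L$ is a pair $(\mathcal{L},\mathcal{R})$ of sets of relations such that every relation $a\leq b$ factors as $a\leq x\leq b$ with $(a,x)\in\mathcal{L}$, $(x,b)\in\mathcal{R}$, $\mathcal{L}$ is exactly the set of relations lifting on the left every relation of $\mathcal{R}$, and $\mathcal{R}$ is exactly the set of relations lifted on the left by every relation of $\mathcal{L}$. $\operatorname{Wfs}(L)$ is the (trim) lattice of these, ordered by inclusion of right classes; its spine is the union of all its chains of maximal length. -}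

module Defs where

open import Data.Nat using (ℕ; _≤_)
open import Data.Fin using (Fin)
open import Data.Bool using (Bool; T)
open import Data.Product using (Σ; ∃; _×_)
open import Data.Sum using (_⊎_)
open import Data.Unit using (⊤)
open import Data.List using (List; []; _∷_; length)
open import Data.List.Relation.Unary.Any using (Any)
open import Relation.Nullary using (¬_)
open import Relation.Binary.PropositionalEquality using (_≡_)
open import Relation.Binary.Lattice.Structures using (IsLattice)
open import Function.Bundles using (_⇔_)

record FinLattice (n : ℕ) : Set where
  field
    le        : Fin n → Fin n → Bool
    _∨_ _∧_   : Fin n → Fin n → Fin n
    isLattice : IsLattice _≡_ (λ a b → T (le a b)) _∨_ _∧_

module _ {n : ℕ} (L : FinLattice n) where
  open FinLattice L

  _⊑_ : Fin n → Fin n → Set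
  a ⊑ b = T (le a b)

  -- A class of relations: a (decidable) subset of Fin n × Fin n,
  -- required below to be contained in Rel(L).
  Cls : Set
  Cls = Fin n → Fin n → Bool

  _∋_,_ : Cls → Fin n → Fin n → Set
  S ∋ a , b = T (S a b)

  SubRel : Cls → Set
  SubRel S = ∀ a b → S ∋ a , b → a ⊑ b

  -- (a,b) lifts on the left (c,d)
  Lifts : Fin n → Fin n → Fin n → Fin n → Set
  Lifts a b c d = a ⊑ c → b ⊑ d → b ⊑ c

  record IsWfs (𝓛 𝓡 : Cls) : Set where
    field
      𝓛⊆Rel : SubRel 𝓛
      𝓡⊆Rel : SubRel 𝓡
      factor : ∀ a b → a ⊑ b →
               ∃ λ x → a ⊑ x × x ⊑ b × 𝓛 ∋ a , x × 𝓡 ∋ x , b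
      𝓛-char : ∀ a b → a ⊑ b →
               (𝓛 ∋ a , b) ⇔ (∀ c d → 𝓡 ∋ c , d → Lifts a b c d)
      𝓡-char : ∀ c d → c ⊑ d →
               (𝓡 ∋ c , d) ⇔ (∀ a b → 𝓛 ∋ a , b → Lifts a b c d)

  record Wfs : Set where
    constructor wfs
    field
      𝓛 𝓡 : Cls
      isWfs : IsWfs 𝓛 𝓡
  open Wfs public

  _≈W_ : Wfs → Wfs → Set
  W ≈W V = (∀ a b → 𝓛 W a b ≡ 𝓛 V a b) × (∀ a b → 𝓡 W a b ≡ 𝓡 V a b)

  _≤W_ : Wfs → Wfs → Set
  W ≤W V = ∀ a b → 𝓡 W ∋ a , b → 𝓡 V ∋ a , b

  _<W_ : Wfs → Wfs → Set
  W <W V = W ≤W V × ¬ (V ≤W W)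

  IsChain : List Wfs → Set
  IsChain []            = ⊤
  IsChain (W ∷ [])      = ⊤
  IsChain (W ∷ V ∷ Ws)  = W <W V × IsChain (V ∷ Ws)

  IsMaxLengthChain : List Wfs → Set
  IsMaxLengthChain c = IsChain c × (∀ c' → IsChain c' → length c' ≤ length c)

  OnSpine : Wfs → Set
  OnSpine W = ∃ λ c → IsMaxLengthChain c × Any (W ≈W_) c

  CoversRel : Wfs → Set
  CoversRel W = ∀ a b → a ⊑ b → 𝓛 W ∋ a , b ⊎ 𝓡 W ∋ a , b

{-# OPTIONS --safe #-}
module Submission where

-- For a weak factorization system W let #𝓡 W and #𝓛 W count the non-identity relations in its
-- right and left class, and #Rel those of L. As 𝓛 ∩ 𝓡 contains only identities,
-- #𝓡 W + #𝓛 W ≤ #Rel, with equality exactly when 𝓛 ∪ 𝓡 = Rel(L). Going up a strict chain of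
-- Wfs(L), #𝓡 strictly increases and #𝓛 strictly decreases, so a chain through W has at most
-- #𝓡 W + #𝓛 W + 1 elements and every chain at most #Rel + 1.
-- Conversely, when 𝓛 ∪ 𝓡 = Rel(L), moving a maximal non-identity relation from 𝓡 to 𝓛 (or a
-- minimal one from 𝓛 to 𝓡) gives a system with the same property one step lower (higher), since
-- extremality is exactly what the new lifting conditions require. Iterating builds a chain of
-- #Rel + 1 elements through W. The system (Rel(L), identities) is covering, so #Rel + 1 is the
-- maximal length of a chain, and W is on a maximal chain iff #𝓡 W + #𝓛 W = #Rel.

open import Defs hiding (_⊑_; _≤W_; _<W_)
open import Data.Bool using (Bool; true; false; T; not; _∧_; _∨_)
open import Data.Bool.Properties using (T?; T-∨; ∧-identityʳ; ∧-zeroʳ; ∧-assoc; ∧-comm; ∧-distribʳ-∨)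
open import Data.Empty using (⊥; ⊥-elim)
open import Data.Fin using (Fin; zero; suc; _≟_)
open import Data.Fin.Induction using (po-noetherian)
open import Data.Fin.Properties using (any?) renaming (suc-injective to Fin-suc-injective)
open import Data.List using (List; []; _∷_; length; _ʳ++_)
open import Data.List.Properties using (length-ʳ++)
open import Data.List.Relation.Unary.Any using (Any; here; there)
open import Data.Nat using (ℕ; zero; suc; _+_; _≤_; _<_; z≤n; s≤s; z<s)
open import Data.Nat.Properties
  using (+-0-commutativeMonoid; +-mono-≤; +-mono-<-≤; +-mono-≤-<; +-monoˡ-≤; +-monoʳ-≤; +-suc;
         ≤-trans; ≤-antisym; ≤-pred; <⇒≱; ≰⇒>; m≤n+m; m+n≤o⇒n≤o; suc-injective; module ≤-Reasoning)
open import Algebra.Properties.CommutativeMonoid.Sum +-0-commutativeMonoid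
  using (sum; sum-syntax; sum-cong-≗; ∑-distrib-+)
open import Data.Product using (∃; ∃₂; _×_; _,_; proj₁; proj₂)
open import Data.Sum using (_⊎_; inj₁; inj₂; swap)
open import Data.Vec.Functional using (Vector)
open import Function using (_∘_; flip; _⇔_; mk⇔; Equivalence)
open import Induction.WellFounded using (Acc; acc)
open import Relation.Binary using (Rel; IsPartialOrder)
open import Relation.Binary.Lattice.Structures using (IsLattice)
import Relation.Binary.Construct.Flip.EqAndOrd as Flip
import Relation.Binary.Construct.NonStrictToStrict as NonStrictToStrict
open import Relation.Binary.PropositionalEquality
  using (_≡_; _≢_; refl; sym; trans; cong; cong₂; subst; module ≡-Reasoning)
open import Relation.Nullary using (¬_; Dec; yes; no; isYes; contradiction)
open import Relation.Nullary.Decidable using (_×-dec_; ¬?; toWitness; fromWitness; decidable-stable)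
open import Relation.Unary using (Pred)

Any-ʳ++⁺ʳ : ∀ {a p} {A : Set a} {P : Pred A p} (xs : List A) {ys} → Any P ys → Any P (xs ʳ++ ys)
Any-ʳ++⁺ʳ []       p = p
Any-ʳ++⁺ʳ (x ∷ xs) p = Any-ʳ++⁺ʳ xs (there p)

-- Counting relations on Fin n

sum-mono-≤ : ∀ {m} {f g : Vector ℕ m} → (∀ i → f i ≤ g i) → sum f ≤ sum g
sum-mono-≤ {zero}  f≤g = z≤n
sum-mono-≤ {suc m} f≤g = +-mono-≤ (f≤g zero) (sum-mono-≤ (f≤g ∘ suc))

sum-mono-< : ∀ {m} {f g : Vector ℕ m} → (∀ i → f i ≤ g i) → ∀ j → f j < g j → sum f < sum g
sum-mono-< {suc m} f≤g zero    fj<gj = +-mono-<-≤ fj<gj (sum-mono-≤ (f≤g ∘ suc))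
sum-mono-< {suc m} f≤g (suc j) fj<gj = +-mono-≤-< (f≤g zero) (sum-mono-< (f≤g ∘ suc) j fj<gj)

sum-suc-at : ∀ {m} {f g : Vector ℕ m} j → (∀ i → i ≢ j → f i ≡ g i) → g j ≡ suc (f j) →
             sum g ≡ suc (sum f)
sum-suc-at zero    f≡g gj = cong₂ _+_ gj (sum-cong-≗ (λ i → sym (f≡g (suc i) λ ())))
sum-suc-at {f = f} {g} (suc j) f≡g gj = begin
  g zero + sum (g ∘ suc)        ≡⟨ cong₂ _+_ (sym (f≡g zero λ ())) (sum-suc-at j f∘suc≡g∘suc gj) ⟩
  f zero + suc (sum (f ∘ suc))  ≡⟨ +-suc (f zero) (sum (f ∘ suc)) ⟩
  suc (sum f)                   ∎
  where
  open ≡-Reasoning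
  f∘suc≡g∘suc : ∀ i → i ≢ j → f (suc i) ≡ g (suc i)
  f∘suc≡g∘suc i i≢j = f≡g (suc i) (i≢j ∘ Fin-suc-injective)

sum-positive : ∀ {m} {f : Vector ℕ m} → 0 < sum f → ∃ λ i → 0 < f i
sum-positive {suc m} {f} 0<Σf with f zero in f₀≡
... | suc _ = zero , subst (0 <_) (sym f₀≡) z<s
... | zero  = let i , 0<fi = sum-positive 0<Σf in suc i , 0<fi

χ : Bool → ℕ
χ true  = 1
χ false = 0

χ-mono : ∀ {x y} → (T x → T y) → χ x ≤ χ y
χ-mono {false}        _   = z≤n
χ-mono {true} {true}  _   = s≤s z≤n
χ-mono {true} {false} x⇒y = ⊥-elim (x⇒y _)

χ-< : ∀ {x y} → ¬ T x → T y → χ x < χ y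
χ-< {false} {true} _  _ = s≤s z≤n
χ-< {true}         ¬x _ = ⊥-elim (¬x _)

χ-∨ : ∀ {x y} → (T x → T y → ⊥) → χ (x ∨ y) ≡ χ x + χ y
χ-∨ {false}        _   = refl
χ-∨ {true} {false} _   = refl
χ-∨ {true} {true}  x#y = ⊥-elim (x#y _ _)

χ-positive : ∀ {x} → 0 < χ x → T x
χ-positive {true} _ = _

BRel : ℕ → Set
BRel n = Fin n → Fin n → Bool

module _ {n : ℕ} where

  infix  4 _⊆_
  infixl 6 _∪_ _∖_

  _⊆_ : BRel n → BRel n → Set
  P ⊆ Q = ∀ a b → T (P a b) → T (Q a b)

  Disjoint : BRel n → BRel n → Set
  Disjoint P Q = ∀ a b → T (P a b) → T (Q a b) → ⊥

  opaque
    _∪_ _∖_ : BRel n → BRel n → BRel n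
    (P ∪ Q) a b = P a b ∨ Q a b
    (P ∖ Q) a b = P a b ∧ not (Q a b)

    Δ : BRel n
    Δ a b = isYes (a ≟ b)

    ⟨_,_⟩ : Fin n → Fin n → BRel n
    ⟨ c , d ⟩ a b = isYes ((a ≟ c) ×-dec (b ≟ d))

  module _ {P Q : BRel n} {a b : Fin n} where
    opaque
      unfolding _∪_ _∖_

      ∪⁺ˡ : T (P a b) → T ((P ∪ Q) a b)
      ∪⁺ˡ = Equivalence.from T-∨ ∘ inj₁

      ∪⁺ʳ : T (Q a b) → T ((P ∪ Q) a b)
      ∪⁺ʳ = Equivalence.from T-∨ ∘ inj₂

      ∪⁻ : T ((P ∪ Q) a b) → T (P a b) ⊎ T (Q a b)
      ∪⁻ = Equivalence.to T-∨

      ∖⁺ : T (P a b) → ¬ T (Q a b) → T ((P ∖ Q) a b)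
      ∖⁺ ab∈P ab∉Q with P a b | Q a b
      ... | true | false = _
      ... | true | true  = ab∉Q _

      ∖⁻ : T ((P ∖ Q) a b) → T (P a b) × ¬ T (Q a b)
      ∖⁻ ab∈P∖Q with P a b | Q a b
      ... | true | false = _ , λ ()

      χ-∪ : Disjoint P Q → χ ((P ∪ Q) a b) ≡ χ (P a b) + χ (Q a b)
      χ-∪ P#Q = χ-∨ (P#Q a b)

  opaque
    unfolding _∪_ _∖_

    ∖-distribʳ-∪ : ∀ P Q R a b → ((P ∪ Q) ∖ R) a b ≡ ((P ∖ R) ∪ (Q ∖ R)) a b
    ∖-distribʳ-∪ P Q R a b = ∧-distribʳ-∨ (not (R a b)) (P a b) (Q a b)

  module _ {a b : Fin n} where
    opaque
      unfolding Δ ⟨_,_⟩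

      Δ⁺ : a ≡ b → T (Δ a b)
      Δ⁺ = fromWitness

      Δ⁻ : T (Δ a b) → a ≡ b
      Δ⁻ = toWitness

      ⟨⟩⁺ : ∀ {c d} → a ≡ c × b ≡ d → T (⟨ c , d ⟩ a b)
      ⟨⟩⁺ = fromWitness

      ⟨⟩⁻ : ∀ {c d} → T (⟨ c , d ⟩ a b) → a ≡ c × b ≡ d
      ⟨⟩⁻ = toWitness

  opaque
    unfolding _∖_ ⟨_,_⟩

    ∖-⟨⟩-miss : ∀ {P c d a b} → ¬ (a ≡ c × b ≡ d) → (P ∖ ⟨ c , d ⟩) a b ≡ P a b
    ∖-⟨⟩-miss {P} {c} {d} {a} {b} ab≢cd with (a ≟ c) ×-dec (b ≟ d)
    ... | yes ab≡cd = contradiction ab≡cd ab≢cd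
    ... | no  _     = ∧-identityʳ (P a b)

    ∖-⟨⟩-hit : ∀ {P c d} → (P ∖ ⟨ c , d ⟩) c d ≡ false
    ∖-⟨⟩-hit {P} {c} {d} with (c ≟ c) ×-dec (d ≟ d)
    ... | yes _     = ∧-zeroʳ (P c d)
    ... | no  cd≢cd = contradiction (refl , refl) cd≢cd

    ∖-comm : ∀ P Q R a b → ((P ∖ Q) ∖ R) a b ≡ ((P ∖ R) ∖ Q) a b
    ∖-comm P Q R a b = begin
      (P a b ∧ not (Q a b)) ∧ not (R a b)  ≡⟨ ∧-assoc (P a b) _ _ ⟩
      P a b ∧ (not (Q a b) ∧ not (R a b))  ≡⟨ cong (P a b ∧_) (∧-comm (not (Q a b)) _) ⟩
      P a b ∧ (not (R a b) ∧ not (Q a b))  ≡⟨ ∧-assoc (P a b) _ _ ⟨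
      (P a b ∧ not (R a b)) ∧ not (Q a b)  ∎
      where open ≡-Reasoning

  ∖-monoˡ : ∀ {P Q R} → P ⊆ Q → P ∖ R ⊆ Q ∖ R
  ∖-monoˡ P⊆Q a b ab∈P∖R = let ab∈P , ab∉R = ∖⁻ ab∈P∖R in ∖⁺ (P⊆Q a b ab∈P) ab∉R

  opaque
    count : BRel n → ℕ
    count P = ∑[ a < n ] ∑[ b < n ] χ (P a b)

    count-cong : ∀ {P Q} → (∀ a b → P a b ≡ Q a b) → count P ≡ count Q
    count-cong P≡Q = sum-cong-≗ λ a → sum-cong-≗ λ b → cong χ (P≡Q a b)

    count-mono : ∀ {P Q} → P ⊆ Q → count P ≤ count Q
    count-mono P⊆Q = sum-mono-≤ λ a → sum-mono-≤ λ b → χ-mono (P⊆Q a b)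

    count-≤⇒⊇ : ∀ {P Q} → P ⊆ Q → count Q ≤ count P → Q ⊆ P
    count-≤⇒⊇ {P} {Q} P⊆Q #Q≤#P a b ab∈Q with T? (P a b)
    ... | yes ab∈P = ab∈P
    ... | no  ab∉P = contradiction #Q≤#P (<⇒≱ (sum-mono-< rows-mono a row-a-<))
      where
      entries-mono : ∀ a b → χ (P a b) ≤ χ (Q a b)
      entries-mono a b = χ-mono (P⊆Q a b)
      rows-mono : ∀ a → ∑[ b < n ] χ (P a b) ≤ ∑[ b < n ] χ (Q a b)
      rows-mono a = sum-mono-≤ (entries-mono a)
      row-a-< : ∑[ b < n ] χ (P a b) < ∑[ b < n ] χ (Q a b)
      row-a-< = sum-mono-< (entries-mono a) b (χ-< ab∉P ab∈Q)

    count-∪ : ∀ {P Q} → Disjoint P Q → count (P ∪ Q) ≡ count P + count Q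
    count-∪ {P} {Q} P#Q = begin
      ∑[ a < n ] ∑[ b < n ] χ ((P ∪ Q) a b)
        ≡⟨ sum-cong-≗ {n} (λ a → sum-cong-≗ {n} λ b → χ-∪ P#Q) ⟩
      ∑[ a < n ] ∑[ b < n ] (χ (P a b) + χ (Q a b))
        ≡⟨ sum-cong-≗ (λ a → ∑-distrib-+ (χ ∘ P a) (χ ∘ Q a)) ⟩
      ∑[ a < n ] (∑[ b < n ] χ (P a b) + ∑[ b < n ] χ (Q a b))
        ≡⟨ ∑-distrib-+ (λ a → ∑[ b < n ] χ (P a b)) (λ a → ∑[ b < n ] χ (Q a b)) ⟩
      count P + count Q
        ∎
      where open ≡-Reasoning

    count-positive : ∀ {P} → 0 < count P → ∃₂ λ a b → T (P a b)
    count-positive 0<#P with sum-positive 0<#P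
    ... | a , 0<row with sum-positive 0<row
    ...   | b , 0<χ = a , b , χ-positive 0<χ

    count-∖-⟨⟩ : ∀ {P c d} → T (P c d) → count P ≡ suc (count (P ∖ ⟨ c , d ⟩))
    count-∖-⟨⟩ {P} {c} {d} cd∈P = sum-suc-at c other-rows (sum-suc-at d other-columns column-d)
      where
      other-rows : ∀ a → a ≢ c → ∑[ b < n ] χ ((P ∖ ⟨ c , d ⟩) a b) ≡ ∑[ b < n ] χ (P a b)
      other-rows a a≢c = sum-cong-≗ {n} λ b → cong χ (∖-⟨⟩-miss {P} (a≢c ∘ proj₁))
      other-columns : ∀ b → b ≢ d → χ ((P ∖ ⟨ c , d ⟩) c b) ≡ χ (P c b)
      other-columns b b≢d = cong χ (∖-⟨⟩-miss {P} (b≢d ∘ proj₂))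
      column-d : χ (P c d) ≡ suc (χ ((P ∖ ⟨ c , d ⟩) c d))
      column-d rewrite ∖-⟨⟩-hit {P} {c} {d} with P c d
      ... | true = refl

  -- Identities lie in both classes of every weak factorization system, so only off-diagonal
  -- pairs are counted.
  opaque
    ∣_∣ : BRel n → ℕ
    ∣ P ∣ = count (P ∖ Δ)

    ∣∣-mono : ∀ {P Q} → P ⊆ Q → ∣ P ∣ ≤ ∣ Q ∣
    ∣∣-mono P⊆Q = count-mono (∖-monoˡ P⊆Q)

    ∣∣-≤⇒⊇ : ∀ {P Q} → P ⊆ Q → (∀ a → T (P a a)) → ∣ Q ∣ ≤ ∣ P ∣ → Q ⊆ P
    ∣∣-≤⇒⊇ {P} {Q} P⊆Q P-refl ∣Q∣≤∣P∣ a b ab∈Q with a ≟ b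
    ... | yes refl = P-refl a
    ... | no  a≢b  = proj₁ (∖⁻ (count-≤⇒⊇ (∖-monoˡ P⊆Q) ∣Q∣≤∣P∣ a b (∖⁺ ab∈Q (a≢b ∘ Δ⁻))))

    ∣∣-positive : ∀ {P} → 0 < ∣ P ∣ → ∃₂ λ a b → T ((P ∖ Δ) a b)
    ∣∣-positive = count-positive

    ∣∣-∖-⟨⟩ : ∀ {P c d} → T (P c d) → c ≢ d → ∣ P ∣ ≡ suc ∣ P ∖ ⟨ c , d ⟩ ∣
    ∣∣-∖-⟨⟩ {P} {c} {d} cd∈P c≢d =
      trans (count-∖-⟨⟩ (∖⁺ cd∈P (c≢d ∘ Δ⁻))) (cong suc (count-cong (∖-comm P Δ ⟨ c , d ⟩)))

    ∣∣-∪ : ∀ {P Q} → (∀ {a b} → T (P a b) → T (Q a b) → a ≡ b) → ∣ P ∪ Q ∣ ≡ ∣ P ∣ + ∣ Q ∣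
    ∣∣-∪ {P} {Q} P∩Q⊆Δ = trans (count-cong (∖-distribʳ-∪ P Q Δ)) (count-∪ off-diagonal-disjoint)
      where
      off-diagonal-disjoint : Disjoint (P ∖ Δ) (Q ∖ Δ)
      off-diagonal-disjoint a b ab∈P∖Δ ab∈Q∖Δ =
        proj₂ (∖⁻ ab∈P∖Δ) (Δ⁺ (P∩Q⊆Δ (proj₁ (∖⁻ ab∈P∖Δ)) (proj₁ (∖⁻ ab∈Q∖Δ))))

  ∣∣-cong : ∀ {P Q} → (∀ a b → P a b ≡ Q a b) → ∣ P ∣ ≡ ∣ Q ∣
  ∣∣-cong P≡Q = ≤-antisym (∣∣-mono λ a b → subst T (P≡Q a b)) (∣∣-mono λ a b → subst T (sym (P≡Q a b)))

-- Extremal elements of finite posets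

module Extremal {n ℓ} {_≼_ : Rel (Fin n) ℓ} (isPO : IsPartialOrder _≡_ _≼_)
                (_≼?_ : ∀ x y → Dec (x ≼ y)) where

  open NonStrictToStrict _≡_ _≼_ using () renaming (_<_ to _≺_)

  maximal : ∀ {p} {P : Pred (Fin n) p} → (∀ x → Dec (P x)) → ∀ {a} → P a →
            ∃ λ m → P m × (∀ {x} → P x → m ≼ x → x ≡ m)
  maximal {P = P} P? = climb (po-noetherian isPO _)
    where
    climb : ∀ {a} → Acc (flip _≺_) a → P a → ∃ λ m → P m × (∀ {x} → P x → m ≼ x → x ≡ m)
    climb {a} (acc above) pa with any? (λ x → P? x ×-dec (a ≼? x) ×-dec ¬? (a ≟ x))
    ... | yes (x , px , a≼x , a≢x) = climb (above (a≼x , a≢x)) px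
    ... | no  nothing-above = a , pa , λ {x} px a≼x →
      decidable-stable (x ≟ a) λ x≢a → nothing-above (x , px , a≼x , x≢a ∘ sym)

  maximalPair : ∀ {p} {P : Fin n → Fin n → Set p} → (∀ x y → Dec (P x y)) → ∀ {a b} → P a b →
                ∃₂ λ c d → P c d × (∀ {x y} → P x y → c ≼ x → d ≼ y → x ≡ c × y ≡ d)
  maximalPair {P = P} P? pab =
    let c , (d₀ , pcd₀) , c-max = maximal (λ x → any? (P? x)) (_ , pab)
        d , pcd , d-max         = maximal (P? c) pcd₀
    in  c , d , pcd , λ {x} {y} pxy c≼x d≼y →
          let x≡c = c-max (y , pxy) c≼x
          in  x≡c , d-max (subst (λ x → P x y) x≡c pxy) d≼y

-- Weak factorization systems on a finite lattice

module _ {n : ℕ} (L : FinLattice n) where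

  open FinLattice L using (le; isLattice)
  open IsLattice isLattice using (isPartialOrder)
  open IsPartialOrder isPartialOrder using (antisym) renaming (refl to ⊑-refl)

  infix 4 _⊑_ _⊑?_ _≤W_ _<W_

  _⊑_ : Fin n → Fin n → Set
  _⊑_ = Defs._⊑_ L

  _⊑?_ : ∀ a b → Dec (a ⊑ b)
  a ⊑? b = T? (le a b)

  _≤W_ _<W_ : Wfs L → Wfs L → Set
  _≤W_ = Defs._≤W_ L
  _<W_ = Defs._<W_ L

  open Extremal isPartialOrder _⊑?_ using (maximalPair)
  open Extremal (Flip.isPartialOrder isPartialOrder) (flip _⊑?_)
    using () renaming (maximalPair to minimalPair)

  module _ (W : Wfs L) where
    open IsWfs (isWfs W) public using (𝓛⊆Rel; 𝓡⊆Rel; 𝓛-char; 𝓡-char)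

    𝓛-lifts-𝓡 : ∀ {a b c d} → T (𝓛 W a b) → T (𝓡 W c d) → Lifts L a b c d
    𝓛-lifts-𝓡 {a} {b} {c} {d} ab∈𝓛 = Equivalence.to (𝓛-char a b (𝓛⊆Rel a b ab∈𝓛)) ab∈𝓛 c d

    𝓛-refl : ∀ a → T (𝓛 W a a)
    𝓛-refl a = Equivalence.from (𝓛-char a a ⊑-refl) λ _ _ _ a⊑c _ → a⊑c

    𝓡-refl : ∀ a → T (𝓡 W a a)
    𝓡-refl a = Equivalence.from (𝓡-char a a ⊑-refl) λ _ _ _ _ b⊑a → b⊑a

    𝓛∩𝓡⇒≡ : ∀ {a b} → T (𝓛 W a b) → T (𝓡 W a b) → a ≡ b
    𝓛∩𝓡⇒≡ {a} {b} ab∈𝓛 ab∈𝓡 = antisym (𝓛⊆Rel a b ab∈𝓛) (𝓛-lifts-𝓡 ab∈𝓛 ab∈𝓡 ⊑-refl ⊑-refl)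

  ≤W⇔𝓛⊇ : ∀ {W V} → W ≤W V ⇔ 𝓛 V ⊆ 𝓛 W
  ≤W⇔𝓛⊇ {W} {V} = mk⇔ 𝓛-antitone 𝓛⊇⇒≤W
    where
    𝓛-antitone : W ≤W V → 𝓛 V ⊆ 𝓛 W
    𝓛-antitone W≤V a b ab∈𝓛V =
      Equivalence.from (𝓛-char W a b (𝓛⊆Rel V a b ab∈𝓛V)) λ c d cd∈𝓡W →
        𝓛-lifts-𝓡 V ab∈𝓛V (W≤V c d cd∈𝓡W)
    𝓛⊇⇒≤W : 𝓛 V ⊆ 𝓛 W → W ≤W V
    𝓛⊇⇒≤W 𝓛V⊆𝓛W c d cd∈𝓡W =
      Equivalence.from (𝓡-char V c d (𝓡⊆Rel W c d cd∈𝓡W)) λ a b ab∈𝓛V →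
        𝓛-lifts-𝓡 W (𝓛V⊆𝓛W a b ab∈𝓛V) cd∈𝓡W

  #𝓡 #𝓛 : Wfs L → ℕ
  #𝓡 W = ∣ 𝓡 W ∣
  #𝓛 W = ∣ 𝓛 W ∣

  #Rel : ℕ
  #Rel = ∣ le ∣

  <W⇒#𝓡< : ∀ {W V} → W <W V → #𝓡 W < #𝓡 V
  <W⇒#𝓡< {W} {V} (W≤V , V≰W) = ≰⇒> λ #𝓡V≤#𝓡W → V≰W (∣∣-≤⇒⊇ W≤V (𝓡-refl W) #𝓡V≤#𝓡W)

  <W⇒#𝓛> : ∀ {W V} → W <W V → #𝓛 V < #𝓛 W
  <W⇒#𝓛> {W} {V} (W≤V , V≰W) = ≰⇒> λ #𝓛W≤#𝓛V →
    let 𝓛V⊆𝓛W = Equivalence.to (≤W⇔𝓛⊇ {W} {V}) W≤V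
    in  V≰W (Equivalence.from (≤W⇔𝓛⊇ {V} {W}) (∣∣-≤⇒⊇ 𝓛V⊆𝓛W (𝓛-refl V) #𝓛W≤#𝓛V))

  module _ (W : Wfs L) where

    private
      𝓡∪𝓛⊆Rel : 𝓡 W ∪ 𝓛 W ⊆ le
      𝓡∪𝓛⊆Rel a b ab∈𝓡∪𝓛 with ∪⁻ ab∈𝓡∪𝓛
      ... | inj₁ ab∈𝓡 = 𝓡⊆Rel W a b ab∈𝓡
      ... | inj₂ ab∈𝓛 = 𝓛⊆Rel W a b ab∈𝓛

      ∣𝓡∪𝓛∣≡#𝓡+#𝓛 : ∣ 𝓡 W ∪ 𝓛 W ∣ ≡ #𝓡 W + #𝓛 W
      ∣𝓡∪𝓛∣≡#𝓡+#𝓛 = ∣∣-∪ λ ab∈𝓡 ab∈𝓛 → 𝓛∩𝓡⇒≡ W ab∈𝓛 ab∈𝓡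

    #𝓡+#𝓛≤#Rel : #𝓡 W + #𝓛 W ≤ #Rel
    #𝓡+#𝓛≤#Rel = subst (_≤ #Rel) ∣𝓡∪𝓛∣≡#𝓡+#𝓛 (∣∣-mono 𝓡∪𝓛⊆Rel)

    covers⇔#Rel≤#𝓡+#𝓛 : CoversRel L W ⇔ #Rel ≤ #𝓡 W + #𝓛 W
    covers⇔#Rel≤#𝓡+#𝓛 = mk⇔
      (λ W-covers → subst (#Rel ≤_) ∣𝓡∪𝓛∣≡#𝓡+#𝓛 (∣∣-mono (covers⇒Rel⊆𝓡∪𝓛 W-covers)))
      (λ #Rel≤ a b a⊑b → swap (∪⁻ (≤⇒Rel⊆𝓡∪𝓛 #Rel≤ a b a⊑b)))
      where
      covers⇒Rel⊆𝓡∪𝓛 : CoversRel L W → le ⊆ 𝓡 W ∪ 𝓛 W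
      covers⇒Rel⊆𝓡∪𝓛 W-covers a b a⊑b with W-covers a b a⊑b
      ... | inj₁ ab∈𝓛 = ∪⁺ʳ ab∈𝓛
      ... | inj₂ ab∈𝓡 = ∪⁺ˡ ab∈𝓡
      ≤⇒Rel⊆𝓡∪𝓛 : #Rel ≤ #𝓡 W + #𝓛 W → le ⊆ 𝓡 W ∪ 𝓛 W
      ≤⇒Rel⊆𝓡∪𝓛 #Rel≤ =
        ∣∣-≤⇒⊇ 𝓡∪𝓛⊆Rel (λ a → ∪⁺ˡ (𝓡-refl W a)) (subst (#Rel ≤_) (sym ∣𝓡∪𝓛∣≡#𝓡+#𝓛) #Rel≤)

    covers⇒#𝓡+#𝓛≡#Rel : CoversRel L W → #𝓡 W + #𝓛 W ≡ #Rel
    covers⇒#𝓡+#𝓛≡#Rel W-covers = ≤-antisym #𝓡+#𝓛≤#Rel (Equivalence.to covers⇔#Rel≤#𝓡+#𝓛 W-covers)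

  ≈W⇒#𝓡≡ : ∀ {W V} → _≈W_ L W V → #𝓡 W ≡ #𝓡 V
  ≈W⇒#𝓡≡ (_ , 𝓡W≡𝓡V) = ∣∣-cong 𝓡W≡𝓡V

  ≈W⇒#𝓛≡ : ∀ {W V} → _≈W_ L W V → #𝓛 W ≡ #𝓛 V
  ≈W⇒#𝓛≡ (𝓛W≡𝓛V , _) = ∣∣-cong 𝓛W≡𝓛V

  length-above≤#𝓛 : ∀ {W Vs} → IsChain L (W ∷ Vs) → length Vs ≤ #𝓛 W
  length-above≤#𝓛 {W} {[]}     _             = z≤n
  length-above≤#𝓛 {W} {V ∷ Vs} (W<V , chain) = ≤-trans (s≤s (length-above≤#𝓛 chain)) (<W⇒#𝓛> {W} {V} W<V)

  length-chain≤ : ∀ {c} → IsChain L c → length c ≤ suc #Rel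
  length-chain≤ {[]}     _     = z≤n
  length-chain≤ {W ∷ Vs} chain = s≤s (begin
    length Vs       ≤⟨ length-above≤#𝓛 chain ⟩
    #𝓛 W            ≤⟨ m≤n+m (#𝓛 W) (#𝓡 W) ⟩
    #𝓡 W + #𝓛 W     ≤⟨ #𝓡+#𝓛≤#Rel W ⟩
    #Rel            ∎)
    where open ≤-Reasoning

  #𝓡+length≤ : ∀ {W V Vs} → IsChain L (V ∷ Vs) → Any (_≈W_ L W) (V ∷ Vs) → #𝓡 V + length Vs ≤ #𝓡 W + #𝓛 W
  #𝓡+length≤ {W} {V} {Vs} chain (here W≈V) =
    begin
    #𝓡 V + length Vs  ≤⟨ +-monoʳ-≤ (#𝓡 V) (length-above≤#𝓛 chain) ⟩
    #𝓡 V + #𝓛 V       ≡⟨ cong₂ _+_ (≈W⇒#𝓡≡ {W} {V} W≈V) (≈W⇒#𝓛≡ {W} {V} W≈V) ⟨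
    #𝓡 W + #𝓛 W       ∎
    where open ≤-Reasoning
  #𝓡+length≤ {W} {V} {V′ ∷ Vs} (V<V′ , chain) (there W∈) = begin
    #𝓡 V + suc (length Vs)  ≡⟨ +-suc (#𝓡 V) (length Vs) ⟩
    suc (#𝓡 V) + length Vs  ≤⟨ +-monoˡ-≤ (length Vs) (<W⇒#𝓡< {V} {V′} V<V′) ⟩
    #𝓡 V′ + length Vs       ≤⟨ #𝓡+length≤ {W} chain W∈ ⟩
    #𝓡 W + #𝓛 W             ∎
    where open ≤-Reasoning

  length-chain-through≤ : ∀ {W c} → IsChain L c → Any (_≈W_ L W) c → length c ≤ suc (#𝓡 W + #𝓛 W)
  length-chain-through≤ {W} {V ∷ Vs} chain W∈c = s≤s (m+n≤o⇒n≤o (#𝓡 V) (#𝓡+length≤ {W} chain W∈c))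

  record IsCoveringPair (𝓛′ 𝓡′ : BRel n) : Set where
    field
      𝓛′⊆Rel  : SubRel L 𝓛′
      𝓡′⊆Rel  : SubRel L 𝓡′
      𝓛′-refl : ∀ a → T (𝓛′ a a)
      𝓡′-refl : ∀ a → T (𝓡′ a a)
      covers  : ∀ a b → a ⊑ b → T (𝓛′ a b) ⊎ T (𝓡′ a b)
      lifts   : ∀ {a b c d} → T (𝓛′ a b) → T (𝓡′ c d) → Lifts L a b c d

  -- Covering makes both closure conditions automatic: a relation outside 𝓛′ lies in 𝓡′, and if it
  -- lifts against itself it is an identity.
  isWfs-from-covering : ∀ {𝓛′ 𝓡′} → IsCoveringPair 𝓛′ 𝓡′ → IsWfs L 𝓛′ 𝓡′
  isWfs-from-covering {𝓛′} {𝓡′} p = record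
    { 𝓛⊆Rel  = 𝓛′⊆Rel
    ; 𝓡⊆Rel  = 𝓡′⊆Rel
    ; factor = factorise
    ; 𝓛-char = λ a b a⊑b → mk⇔ (λ ab∈𝓛′ c d → lifts ab∈𝓛′) (𝓛′-closed a b a⊑b)
    ; 𝓡-char = λ c d c⊑d → mk⇔ (λ cd∈𝓡′ a b ab∈𝓛′ → lifts ab∈𝓛′ cd∈𝓡′) (𝓡′-closed c d c⊑d)
    }
    where
    open IsCoveringPair p

    factorise : ∀ a b → a ⊑ b → ∃ λ x → a ⊑ x × x ⊑ b × T (𝓛′ a x) × T (𝓡′ x b)
    factorise a b a⊑b with covers a b a⊑b
    ... | inj₁ ab∈𝓛′ = b , a⊑b , ⊑-refl , ab∈𝓛′ , 𝓡′-refl b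
    ... | inj₂ ab∈𝓡′ = a , ⊑-refl , a⊑b , 𝓛′-refl a , ab∈𝓡′

    𝓛′-closed : ∀ a b → a ⊑ b → (∀ c d → T (𝓡′ c d) → Lifts L a b c d) → T (𝓛′ a b)
    𝓛′-closed a b a⊑b lifts-𝓡′ with covers a b a⊑b
    ... | inj₁ ab∈𝓛′ = ab∈𝓛′
    ... | inj₂ ab∈𝓡′ =
      subst (λ x → T (𝓛′ a x)) (antisym a⊑b (lifts-𝓡′ a b ab∈𝓡′ ⊑-refl ⊑-refl)) (𝓛′-refl a)

    𝓡′-closed : ∀ c d → c ⊑ d → (∀ a b → T (𝓛′ a b) → Lifts L a b c d) → T (𝓡′ c d)
    𝓡′-closed c d c⊑d lifted-by-𝓛′ with covers c d c⊑d
    ... | inj₁ cd∈𝓛′ =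
      subst (λ x → T (𝓡′ c x)) (antisym c⊑d (lifted-by-𝓛′ c d cd∈𝓛′ ⊑-refl ⊑-refl)) (𝓡′-refl c)
    ... | inj₂ cd∈𝓡′ = cd∈𝓡′

  coveringWfs : ∀ {𝓛′ 𝓡′} → IsCoveringPair 𝓛′ 𝓡′ → Wfs L
  coveringWfs p = wfs _ _ (isWfs-from-covering p)

  module MoveToLeft (W : Wfs L) (W-covers : CoversRel L W) {c d : Fin n}
                    (cd∈𝓡∖Δ : T ((𝓡 W ∖ Δ) c d))
                    (cd-maximal : ∀ {x y} → T ((𝓡 W ∖ Δ) x y) → c ⊑ x → d ⊑ y → x ≡ c × y ≡ d) where

    private
      cd∈𝓡 : T (𝓡 W c d)
      cd∈𝓡 = proj₁ (∖⁻ cd∈𝓡∖Δ)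

      c≢d : c ≢ d
      c≢d = proj₂ (∖⁻ cd∈𝓡∖Δ) ∘ Δ⁺

      cd-lifts-𝓡 : ∀ {x y} → T (𝓡 W x y) → ¬ T (⟨ c , d ⟩ x y) → Lifts L c d x y
      cd-lifts-𝓡 {x} {y} xy∈𝓡 xy≢cd c⊑x d⊑y with x ≟ y
      ... | yes refl = d⊑y
      ... | no  x≢y  = contradiction (⟨⟩⁺ (cd-maximal (∖⁺ xy∈𝓡 (x≢y ∘ Δ⁻)) c⊑x d⊑y)) xy≢cd

      𝓛↓ 𝓡↓ : BRel n
      𝓛↓ = 𝓛 W ∪ ⟨ c , d ⟩
      𝓡↓ = 𝓡 W ∖ ⟨ c , d ⟩

      𝓛↓⊆Rel : SubRel L 𝓛↓
      𝓛↓⊆Rel a b ab∈𝓛↓ with ∪⁻ ab∈𝓛↓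
      ... | inj₁ ab∈𝓛  = 𝓛⊆Rel W a b ab∈𝓛
      ... | inj₂ ab≐cd with ⟨⟩⁻ ab≐cd
      ...   | refl , refl = 𝓡⊆Rel W c d cd∈𝓡

      𝓡↓-refl : ∀ a → T (𝓡↓ a a)
      𝓡↓-refl a = ∖⁺ (𝓡-refl W a) λ aa≐cd → let a≡c , a≡d = ⟨⟩⁻ aa≐cd in c≢d (trans (sym a≡c) a≡d)

      𝓛↓∪𝓡↓-covers : ∀ a b → a ⊑ b → T (𝓛↓ a b) ⊎ T (𝓡↓ a b)
      𝓛↓∪𝓡↓-covers a b a⊑b with W-covers a b a⊑b | T? (⟨ c , d ⟩ a b)
      ... | inj₁ ab∈𝓛 | _          = inj₁ (∪⁺ˡ ab∈𝓛)
      ... | inj₂ _    | yes ab≐cd  = inj₁ (∪⁺ʳ ab≐cd)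
      ... | inj₂ ab∈𝓡 | no  ab≢cd  = inj₂ (∖⁺ ab∈𝓡 ab≢cd)

      𝓛↓-lifts-𝓡↓ : ∀ {a b x y} → T (𝓛↓ a b) → T (𝓡↓ x y) → Lifts L a b x y
      𝓛↓-lifts-𝓡↓ ab∈𝓛↓ xy∈𝓡↓ with ∪⁻ ab∈𝓛↓ | ∖⁻ xy∈𝓡↓
      ... | inj₁ ab∈𝓛  | xy∈𝓡 , _     = 𝓛-lifts-𝓡 W ab∈𝓛 xy∈𝓡
      ... | inj₂ ab≐cd | xy∈𝓡 , xy≢cd with ⟨⟩⁻ ab≐cd
      ...   | refl , refl = cd-lifts-𝓡 xy∈𝓡 xy≢cd

      covering : IsCoveringPair 𝓛↓ 𝓡↓
      covering = record
        { 𝓛′⊆Rel  = 𝓛↓⊆Rel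
        ; 𝓡′⊆Rel  = λ a b ab∈𝓡↓ → 𝓡⊆Rel W a b (proj₁ (∖⁻ ab∈𝓡↓))
        ; 𝓛′-refl = λ a → ∪⁺ˡ (𝓛-refl W a)
        ; 𝓡′-refl = 𝓡↓-refl
        ; covers  = 𝓛↓∪𝓡↓-covers
        ; lifts   = 𝓛↓-lifts-𝓡↓
        }

    W↓ : Wfs L
    W↓ = coveringWfs covering

    W↓-covers : CoversRel L W↓
    W↓-covers = IsCoveringPair.covers covering

    W↓<W : W↓ <W W
    W↓<W = (λ a b → proj₁ ∘ ∖⁻) , λ W≤W↓ → proj₂ (∖⁻ (W≤W↓ c d cd∈𝓡)) (⟨⟩⁺ (refl , refl))

    #𝓡W≡1+#𝓡W↓ : #𝓡 W ≡ suc (#𝓡 W↓)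
    #𝓡W≡1+#𝓡W↓ = ∣∣-∖-⟨⟩ cd∈𝓡 c≢d

  module MoveToRight (W : Wfs L) (W-covers : CoversRel L W) {c d : Fin n}
                     (cd∈𝓛∖Δ : T ((𝓛 W ∖ Δ) c d))
                     (cd-minimal : ∀ {x y} → T ((𝓛 W ∖ Δ) x y) → x ⊑ c → y ⊑ d → x ≡ c × y ≡ d) where

    private
      cd∈𝓛 : T (𝓛 W c d)
      cd∈𝓛 = proj₁ (∖⁻ cd∈𝓛∖Δ)

      c≢d : c ≢ d
      c≢d = proj₂ (∖⁻ cd∈𝓛∖Δ) ∘ Δ⁺

      𝓛-lifts-cd : ∀ {a b} → T (𝓛 W a b) → ¬ T (⟨ c , d ⟩ a b) → Lifts L a b c d
      𝓛-lifts-cd {a} {b} ab∈𝓛 ab≢cd a⊑c b⊑d with a ≟ b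
      ... | yes refl = a⊑c
      ... | no  a≢b  = contradiction (⟨⟩⁺ (cd-minimal (∖⁺ ab∈𝓛 (a≢b ∘ Δ⁻)) a⊑c b⊑d)) ab≢cd

      𝓛↑ 𝓡↑ : BRel n
      𝓛↑ = 𝓛 W ∖ ⟨ c , d ⟩
      𝓡↑ = 𝓡 W ∪ ⟨ c , d ⟩

      𝓡↑⊆Rel : SubRel L 𝓡↑
      𝓡↑⊆Rel a b ab∈𝓡↑ with ∪⁻ ab∈𝓡↑
      ... | inj₁ ab∈𝓡  = 𝓡⊆Rel W a b ab∈𝓡
      ... | inj₂ ab≐cd with ⟨⟩⁻ ab≐cd
      ...   | refl , refl = 𝓛⊆Rel W c d cd∈𝓛

      𝓛↑-refl : ∀ a → T (𝓛↑ a a)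
      𝓛↑-refl a = ∖⁺ (𝓛-refl W a) λ aa≐cd → let a≡c , a≡d = ⟨⟩⁻ aa≐cd in c≢d (trans (sym a≡c) a≡d)

      𝓛↑∪𝓡↑-covers : ∀ a b → a ⊑ b → T (𝓛↑ a b) ⊎ T (𝓡↑ a b)
      𝓛↑∪𝓡↑-covers a b a⊑b with W-covers a b a⊑b | T? (⟨ c , d ⟩ a b)
      ... | inj₂ ab∈𝓡 | _          = inj₂ (∪⁺ˡ ab∈𝓡)
      ... | inj₁ _    | yes ab≐cd  = inj₂ (∪⁺ʳ ab≐cd)
      ... | inj₁ ab∈𝓛 | no  ab≢cd  = inj₁ (∖⁺ ab∈𝓛 ab≢cd)

      𝓛↑-lifts-𝓡↑ : ∀ {a b x y} → T (𝓛↑ a b) → T (𝓡↑ x y) → Lifts L a b x y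
      𝓛↑-lifts-𝓡↑ ab∈𝓛↑ xy∈𝓡↑ with ∖⁻ ab∈𝓛↑ | ∪⁻ xy∈𝓡↑
      ... | ab∈𝓛 , _     | inj₁ xy∈𝓡  = 𝓛-lifts-𝓡 W ab∈𝓛 xy∈𝓡
      ... | ab∈𝓛 , ab≢cd | inj₂ xy≐cd with ⟨⟩⁻ xy≐cd
      ...   | refl , refl = 𝓛-lifts-cd ab∈𝓛 ab≢cd

      covering : IsCoveringPair 𝓛↑ 𝓡↑
      covering = record
        { 𝓛′⊆Rel  = λ a b ab∈𝓛↑ → 𝓛⊆Rel W a b (proj₁ (∖⁻ ab∈𝓛↑))
        ; 𝓡′⊆Rel  = 𝓡↑⊆Rel
        ; 𝓛′-refl = 𝓛↑-refl
        ; 𝓡′-refl = λ a → ∪⁺ˡ (𝓡-refl W a)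
        ; covers  = 𝓛↑∪𝓡↑-covers
        ; lifts   = 𝓛↑-lifts-𝓡↑
        }

    W↑ : Wfs L
    W↑ = coveringWfs covering

    W↑-covers : CoversRel L W↑
    W↑-covers = IsCoveringPair.covers covering

    W<W↑ : W <W W↑
    W<W↑ = (λ a b → ∪⁺ˡ) , λ W↑≤W → c≢d (𝓛∩𝓡⇒≡ W cd∈𝓛 (W↑≤W c d (∪⁺ʳ (⟨⟩⁺ (refl , refl)))))

    #𝓛W≡1+#𝓛W↑ : #𝓛 W ≡ suc (#𝓛 W↑)
    #𝓛W≡1+#𝓛W↑ = ∣∣-∖-⟨⟩ cd∈𝓛 c≢d

  stepDown : ∀ {k} (W : Wfs L) → CoversRel L W → #𝓡 W ≡ suc k →
             ∃ λ V → CoversRel L V × V <W W × #𝓡 V ≡ k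
  stepDown W W-covers #𝓡W≡1+k =
    let _ , _ , ab∈𝓡∖Δ         = ∣∣-positive (subst (0 <_) (sym #𝓡W≡1+k) z<s)
        _ , _ , cd∈𝓡∖Δ , cd-max = maximalPair (λ x y → T? ((𝓡 W ∖ Δ) x y)) ab∈𝓡∖Δ
        open MoveToLeft W W-covers cd∈𝓡∖Δ cd-max
    in  W↓ , W↓-covers , W↓<W , suc-injective (trans (sym #𝓡W≡1+#𝓡W↓) #𝓡W≡1+k)

  stepUp : ∀ {k} (W : Wfs L) → CoversRel L W → #𝓛 W ≡ suc k →
           ∃ λ V → CoversRel L V × W <W V × #𝓛 V ≡ k
  stepUp W W-covers #𝓛W≡1+k =
    let _ , _ , ab∈𝓛∖Δ         = ∣∣-positive (subst (0 <_) (sym #𝓛W≡1+k) z<s)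
        _ , _ , cd∈𝓛∖Δ , cd-min = minimalPair (λ x y → T? ((𝓛 W ∖ Δ) x y)) ab∈𝓛∖Δ
        open MoveToRight W W-covers cd∈𝓛∖Δ cd-min
    in  W↑ , W↑-covers , W<W↑ , suc-injective (trans (sym #𝓛W≡1+#𝓛W↑) #𝓛W≡1+k)

  descend : ∀ k {W Vs} → #𝓡 W ≡ k → CoversRel L W → IsChain L (W ∷ Vs) →
            ∃ λ Us → length Us ≡ k × IsChain L (Us ʳ++ W ∷ Vs)
  descend zero    _         _        chain = [] , refl , chain
  descend (suc k) {W} #𝓡W≡1+k W-covers chain =
    let V , V-covers , V<W , #𝓡V≡k = stepDown W W-covers #𝓡W≡1+k
        Us , length≡k , chain′       = descend k #𝓡V≡k V-covers (V<W , chain)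
    in  V ∷ Us , cong suc length≡k , chain′

  ascend : ∀ k {W} → #𝓛 W ≡ k → CoversRel L W → ∃ λ Vs → length Vs ≡ k × IsChain L (W ∷ Vs)
  ascend zero    _         _        = [] , refl , _
  ascend (suc k) {W} #𝓛W≡1+k W-covers =
    let V , V-covers , W<V , #𝓛V≡k = stepUp W W-covers #𝓛W≡1+k
        Vs , length≡k , chain        = ascend k #𝓛V≡k V-covers
    in  V ∷ Vs , cong suc length≡k , (W<V , chain)

  longChainThrough : ∀ W → CoversRel L W →
                     ∃ λ c → IsChain L c × length c ≡ suc #Rel × Any (_≈W_ L W) c
  longChainThrough W W-covers =
    let Vs , length-Vs , chain↑ = ascend _ refl W-covers
        Us , length-Us , chain  = descend _ refl W-covers chain↑
        length-c = begin
          length (Us ʳ++ W ∷ Vs)       ≡⟨ length-ʳ++ Us ⟩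
          length Us + suc (length Vs)  ≡⟨ +-suc (length Us) (length Vs) ⟩
          suc (length Us + length Vs)  ≡⟨ cong suc (cong₂ _+_ length-Us length-Vs) ⟩
          suc (#𝓡 W + #𝓛 W)            ≡⟨ cong suc (covers⇒#𝓡+#𝓛≡#Rel W W-covers) ⟩
          suc #Rel                     ∎
    in  Us ʳ++ W ∷ Vs , chain , length-c , Any-ʳ++⁺ʳ Us (here ((λ _ _ → refl) , (λ _ _ → refl)))
    where open ≡-Reasoning

  Rel-Δ-covering : IsCoveringPair le Δ
  Rel-Δ-covering = record
    { 𝓛′⊆Rel  = λ _ _ a⊑b → a⊑b
    ; 𝓡′⊆Rel  = λ a b ab∈Δ → subst (a ⊑_) (Δ⁻ ab∈Δ) ⊑-refl
    ; 𝓛′-refl = λ _ → ⊑-refl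
    ; 𝓡′-refl = λ _ → Δ⁺ refl
    ; covers  = λ _ _ a⊑b → inj₁ a⊑b
    ; lifts   = λ _ cd∈Δ _ b⊑d → subst (_ ⊑_) (sym (Δ⁻ cd∈Δ)) b⊑d
    }

  longest⇒length≡ : ∀ {c} → IsMaxLengthChain L c → length c ≡ suc #Rel
  longest⇒length≡ {c} (chain , longest) =
    let c₀ , chain₀ , length-c₀ , _ =
          longChainThrough (coveringWfs Rel-Δ-covering) (IsCoveringPair.covers Rel-Δ-covering)
    in  ≤-antisym (length-chain≤ chain) (subst (_≤ length c) length-c₀ (longest c₀ chain₀))

  length≡⇒longest : ∀ {c} → IsChain L c → length c ≡ suc #Rel → IsMaxLengthChain L c
  length≡⇒longest chain length-c =
    chain , λ c′ chain′ → subst (length c′ ≤_) (sym length-c) (length-chain≤ chain′)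

mainTheorem20 : (n : ℕ) (L : FinLattice n) (W : Wfs L) →
    OnSpine L W ⇔ CoversRel L W
mainTheorem20 n L W = mk⇔ onSpine⇒covers covers⇒onSpine
  where
  onSpine⇒covers : OnSpine L W → CoversRel L W
  onSpine⇒covers (c , c-longest , W∈c) = Equivalence.from (covers⇔#Rel≤#𝓡+#𝓛 L W) (≤-pred (begin
    suc (#Rel L)           ≡⟨ longest⇒length≡ L c-longest ⟨
    length c               ≤⟨ length-chain-through≤ L {W} (proj₁ c-longest) W∈c ⟩
    suc (#𝓡 L W + #𝓛 L W)  ∎))
    where open ≤-Reasoning

  covers⇒onSpine : CoversRel L W → OnSpine L W
  covers⇒onSpine W-covers =
    let c , chain , length-c , W∈c = longChainThrough L W W-covers
    in  c , length≡⇒longest L chain length-c , W∈c
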